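{- Let $N$ be a positive integer and let $\mathcal{B}$ be a local factor of $[N]$ of dimension $d$, resolution $M$ and modulus $q$. Then $$|\mathcal{B}|\le qd\Bigl(\frac{N}{M}+2\Bigr).$$
   Context: $[N]=\{1,\dots,N\}$. A factor of $[N]$ is a partition of $[N]$ into sets; $|\mathcal{B}|$ is the number of parts. The join $\mathcal{B}_1\vee\dots\vee\mathcal{B}_d$ of factors is $\{B_1\cap\dots\cap B_d: B_i\in\mathcal{B}_i\}$ (nonempty intersections). A simple real factor of resolution $L$ is a factor of $[N]$ obtained by partitioning $\mathbb{R}$ into intervals all of length $L$ and intersecting with $[N]$. A simple congruence factor of modulus $Q$ is the partition of $[N]$ into congruence classes mod $Q$. A simple local factor of resolution $L$ and modulus $Q$ is the join of a simple real factor of resolution $L$ and a simple congruence factor of modulus $Q$. A local factor of dimension $d$, resolution $M$ and modulus $q$ is the join of $d$ simple local factors $\mathcal{B}_1,\dots,\mathcal{B}_d$, where $\mathcal{B}_i$ has resolution $M_i\ge M$ and modulus $q_i$, and $q=\mathrm{lcm}[q_1,\dots,q_d]$.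
   Formalization: Simple real factors come from partitions of ℚ into intervals with rational endpoints instead of partitions of $\mathbb{R}$, and the resolutions $M_i$ and $M$ are rational. -}

module Defs where

open import Data.Bool using (Bool; true; false; if_then_else_)
open import Data.Nat as ℕ using (ℕ; suc; NonZero; _%_)
open import Data.Nat.LCM using (lcm)
open import Data.Integer as ℤ using (ℤ; +_)
open import Data.Integer.Properties as ℤP using ()
open import Data.Nat.Properties as ℕP using ()
open import Data.Rational using (ℚ; _≤_; _<_; _-_; _/_; Positive)
open import Data.Product using (Σ; _×_; _,_; proj₁)
open import Data.Product.Properties as ×P using ()
open import Data.Vec as Vec using (Vec)
open import Data.Vec.Properties as VecP using ()
open import Data.Fin using (Fin)
open import Data.List using (List; map; upTo; length; deduplicate)
open import Relation.Binary.PropositionalEquality using (_≡_)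
open import Relation.Binary.Definitions using (DecidableEquality)

[_] : ℕ → List ℕ
[ N ] = map suc (upTo N)

ℕ→ℚ : ℕ → ℚ
ℕ→ℚ n = (+ n) / 1

-- Factors of [N] are represented by labelling functions: the parts of
-- the factor are the nonempty fibres of the labelling restricted to [N].

numParts : {A : Set} → DecidableEquality A → (N : ℕ) → (ℕ → A) → ℕ
numParts _≟_ N f = length (deduplicate _≟_ (map f [ N ]))

record Interval : Set where
  field
    lo hi    : ℚ
    loClosed : Bool
    hiClosed : Bool
open Interval public

_∈I_ : ℚ → Interval → Set
x ∈I J = (if loClosed J then lo J ≤ x else lo J < x)
       × (if hiClosed J then x ≤ hi J else x < hi J)

record LinePartition (L : ℚ) : Set where
  field
    pos   : Positive L
    I     : ℤ → Interval
    len   : ∀ k → hi (I k) - lo (I k) ≡ L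
    cover : ∀ (x : ℚ) → Σ ℤ (λ k → x ∈I I k)
    disj  : ∀ (x : ℚ) (k k′ : ℤ) → x ∈I I k → x ∈I I k′ → k ≡ k′
open LinePartition public

realLabel : {L : ℚ} → LinePartition L → ℕ → ℤ
realLabel P n = proj₁ (cover P (ℕ→ℚ n))

congLabel : (Q : ℕ) → .{{NonZero Q}} → ℕ → ℕ
congLabel Q n = n % Q

record SimpleLocalFactor : Set where
  field
    res      : ℚ
    realPart : LinePartition res
    modulus  : ℕ
    {{modulus-nonZero}} : NonZero modulus
open SimpleLocalFactor public

localLabel : SimpleLocalFactor → ℕ → ℤ × ℕ
localLabel B n = realLabel (realPart B) n , congLabel (modulus B) n

joinLabel : {d : ℕ} → Vec SimpleLocalFactor d → ℕ → Vec (ℤ × ℕ) d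
joinLabel Bs n = Vec.map (λ B → localLabel B n) Bs

joinLabel-≟ : {d : ℕ} → DecidableEquality (Vec (ℤ × ℕ) d)
joinLabel-≟ = VecP.≡-dec (×P.≡-dec ℤP._≟_ ℕP._≟_)

joinSize : {d : ℕ} → (N : ℕ) → Vec SimpleLocalFactor d → ℕ
joinSize N Bs = numParts joinLabel-≟ N (joinLabel Bs)

joinModulus : {d : ℕ} → Vec SimpleLocalFactor d → ℕ
joinModulus Bs = Vec.foldr _ (λ B acc → lcm (modulus B) acc) 1 Bs

AllResAtLeast : {d : ℕ} → ℚ → Vec SimpleLocalFactor d → Set
AllResAtLeast M Bs = ∀ i → M ≤ res (Vec.lookup Bs i)

{-# OPTIONS --safe #-}
-- Walk through one residue class modulo q in increasing order. On it every congruence label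
-- is constant (each qᵢ divides q), so the join label can only change where the real label of
-- some Bᵢ changes, and the class meets at most 1 + Σᵢ (changes of Bᵢ) parts. Two different
-- intervals of one line partition met by increasing points are spaced by at least their common
-- length Mᵢ ≥ M, so a walk inside [0, N] changes the real label of Bᵢ at most N/M + 1 times.
-- Each class therefore meets at most 1 + d (N/M + 1) ≤ d (N/M + 2) parts, and there are q classes.

module Submission where

open import Defs
open import Data.Bool using (true; false; if_then_else_)
open import Data.Nat as ℕ using (ℕ; zero; suc; z≤n; s≤s; _%_)
import Data.Nat.Properties as ℕ
open import Algebra.Properties.CommutativeSemigroup ℕ.+-commutativeSemigroup using (interchange)
open import Data.Nat.Coprimality using (1-coprimeTo) renaming (sym to coprime-sym)
open import Data.Nat.Divisibility using (_∣_; ∣-refl; ∣-trans)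
open import Data.Nat.DivMod using (m%n<n; m∣n⇒o%n%m≡o%m)
open import Data.Nat.GCD using (gcd)
open import Data.Nat.LCM using (lcm; m∣lcm[m,n]; n∣lcm[m,n]; gcd*lcm)
open import Data.Integer as ℤ using (ℤ; +_)
import Data.Integer.Properties as ℤ
open import Data.Rational
  using (ℚ; mkℚ; *≤*; *<*; 0ℚ; 1ℚ; _≤_; _<_; _+_; _-_; _*_; _÷_; 1/_; NonZero; Positive; nonNegative)
open import Data.Rational.Properties
  using ( normalize-coprime; /-cong; +-comm; +-assoc; *-assoc; *-distribʳ-+; *-identityˡ; *-identityʳ; *-inverseˡ
        ; *-zeroˡ; +-identityˡ; +-identityʳ; pos⇒nonZero; positive⁻¹; *-cancelʳ-≤-pos
        ; ≤-reflexive; ≤-trans; <⇒≤; ≤-<-trans; <-≤-trans; <-dense; ≮⇒≥; ≰⇒>; _<?_; _≤?_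
        ; +-mono-≤; +-monoˡ-≤; +-monoʳ-≤; *-monoˡ-≤-nonNeg; module ≤-Reasoning)
open import Data.Rational.Solver using (module +-*-Solver)
open import Data.Product using (_,_; proj₁; proj₂)
import Data.Product.Properties as Product
open import Data.Sum using (inj₁; inj₂)
open import Data.Vec using (Vec; _∷_) renaming ([] to [])
import Data.Fin as Fin
open import Data.List using (List; []; _∷_; _++_; map; length; derun; deduplicate; filter; concatMap; upTo)
import Data.List.Properties as List
open import Data.List.Membership.Propositional.Properties
  using ( ∈-∃++; ∈-++⁻; ∈-++⁺ˡ; ∈-++⁺ʳ; ∈-map⁺; ∈-map⁻; ∈-filter⁺; ∈-upTo⁺; ∈-concat⁺′
        ; ∈-derun⁺; ∈-deduplicate⁻)
open import Data.List.Relation.Binary.Subset.Propositional using (_⊆_)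
open import Data.List.Relation.Unary.All as All using (All; []; _∷_)
import Data.List.Relation.Unary.All.Properties as All
open import Data.List.Relation.Unary.Any using (here; there)
open import Data.List.Relation.Unary.AllPairs using (_∷_)
open import Data.List.Relation.Unary.Linked as Linked using (Linked; _∷_)
import Data.List.Relation.Unary.Linked.Properties as Linked
open import Data.List.Relation.Unary.Unique.Propositional using (Unique)
open import Data.List.Relation.Unary.Unique.DecPropositional.Properties using (deduplicate-!)
open import Function using (id; _∘_)
open import Relation.Nullary using (does; yes; no; contradiction)
open import Relation.Binary.Definitions using (DecidableEquality)
open import Relation.Binary.PropositionalEquality hiding ([_])

ℕ→ℚ≡mkℚ : ∀ n → ℕ→ℚ n ≡ mkℚ (+ n) 0 (coprime-sym (1-coprimeTo n))
ℕ→ℚ≡mkℚ n = normalize-coprime {n} {0} (coprime-sym (1-coprimeTo n))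

ℕ→ℚ-+ : ∀ m n → ℕ→ℚ (m ℕ.+ n) ≡ ℕ→ℚ m + ℕ→ℚ n
ℕ→ℚ-+ m n rewrite ℕ→ℚ≡mkℚ m | ℕ→ℚ≡mkℚ n =
  /-cong {p₁ = + (m ℕ.+ n)} {q₁ = 1} {p₂ = + m ℤ.* + 1 ℤ.+ + n ℤ.* + 1} {q₂ = 1}
    (sym (cong₂ ℤ._+_ (ℤ.*-identityʳ (+ m)) (ℤ.*-identityʳ (+ n)))) refl

ℕ→ℚ-mono-≤ : ∀ {m n} → m ℕ.≤ n → ℕ→ℚ m ≤ ℕ→ℚ n
ℕ→ℚ-mono-≤ {m} {n} m≤n rewrite ℕ→ℚ≡mkℚ m | ℕ→ℚ≡mkℚ n =
  *≤* (subst₂ ℤ._≤_ (sym (ℤ.*-identityʳ (+ m))) (sym (ℤ.*-identityʳ (+ n))) (ℤ.+≤+ m≤n))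

ℕ→ℚ-mono-< : ∀ {m n} → m ℕ.< n → ℕ→ℚ m < ℕ→ℚ n
ℕ→ℚ-mono-< {m} {n} m<n rewrite ℕ→ℚ≡mkℚ m | ℕ→ℚ≡mkℚ n =
  *<* (subst₂ ℤ._<_ (sym (ℤ.*-identityʳ (+ m))) (sym (ℤ.*-identityʳ (+ n))) (ℤ.+<+ m<n))

ℕ→ℚ-nonNeg : ∀ n → 0ℚ ≤ ℕ→ℚ n
ℕ→ℚ-nonNeg n = ℕ→ℚ-mono-≤ {0} {n} z≤n

ℕ→ℚ-suc-* : ∀ n p → ℕ→ℚ (suc n) * p ≡ p + ℕ→ℚ n * p
ℕ→ℚ-suc-* n p = begin
  ℕ→ℚ (suc n) * p           ≡⟨ cong (_* p) (ℕ→ℚ-+ 1 n) ⟩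
  (1ℚ + ℕ→ℚ n) * p          ≡⟨ *-distribʳ-+ p 1ℚ (ℕ→ℚ n) ⟩
  1ℚ * p + ℕ→ℚ n * p        ≡⟨ cong (_+ ℕ→ℚ n * p) (*-identityˡ p) ⟩
  p + ℕ→ℚ n * p             ∎
  where open ≡-Reasoning

ℕ→ℚ-suc-*-+ : ∀ n p q → ℕ→ℚ (suc n) * p + q ≡ ℕ→ℚ n * p + (q + p)
ℕ→ℚ-suc-*-+ n p q = trans (cong (_+ q) (ℕ→ℚ-suc-* n p))
  (solve 3 (λ p np q → p :+ np :+ q := np :+ (q :+ p)) refl p (ℕ→ℚ n * p) q)
  where open +-*-Solver

p≤p+q : ∀ {p q} → 0ℚ ≤ q → p ≤ p + q
p≤p+q {p} {q} 0≤q = subst (_≤ p + q) (+-identityʳ p) (+-monoʳ-≤ p 0≤q)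

*≤+⇒≤÷+1 : ∀ {p q} r .{{_ : Positive r}} → p * r ≤ q + r → p ≤ (q ÷ r) {{pos⇒nonZero r}} + 1ℚ
*≤+⇒≤÷+1 {p} {q} r pr≤q+r = *-cancelʳ-≤-pos r (subst (p * r ≤_) (sym [q÷r+1]r≡q+r) pr≤q+r)
  where
  instance _ = pos⇒nonZero r
  open ≡-Reasoning
  open +-*-Solver
  [q÷r+1]r≡q+r : (q ÷ r + 1ℚ) * r ≡ q + r
  [q÷r+1]r≡q+r = begin
    (q * 1/ r + 1ℚ) * r         ≡⟨ solve 4 (λ q i r one → (q :* i :+ one) :* r := q :* (i :* r) :+ one :* r)
                                     refl q (1/ r) r 1ℚ ⟩
    q * (1/ r * r) + 1ℚ * r     ≡⟨ cong₂ (λ u v → q * u + v) (*-inverseˡ r) (*-identityˡ r) ⟩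
    q * 1ℚ + r                  ≡⟨ cong (_+ r) (*-identityʳ q) ⟩
    q + r                       ∎

Unique∧⊆⇒length-≤ : ∀ {A : Set} {xs ys : List A} → Unique xs → xs ⊆ ys → length xs ℕ.≤ length ys
Unique∧⊆⇒length-≤ {xs = []} _ _ = z≤n
Unique∧⊆⇒length-≤ {xs = x ∷ xs} (x∉xs ∷ unique) xs⊆ys with ∈-∃++ (xs⊆ys (here refl))
... | us , vs , refl = begin
  suc (length xs)            ≤⟨ s≤s (Unique∧⊆⇒length-≤ unique xs⊆us++vs) ⟩
  suc (length (us ++ vs))    ≡⟨ cong suc (List.length-++ us) ⟩
  suc (length us ℕ.+ length vs) ≡⟨ ℕ.+-suc (length us) (length vs) ⟨
  length us ℕ.+ length (x ∷ vs) ≡⟨ List.length-++ us ⟨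
  length (us ++ x ∷ vs)      ∎
  where
  open ℕ.≤-Reasoning
  xs⊆us++vs : xs ⊆ us ++ vs
  xs⊆us++vs v∈xs with ∈-++⁻ us (xs⊆ys (there v∈xs))
  ... | inj₁ v∈us         = ∈-++⁺ˡ v∈us
  ... | inj₂ (here refl)  = contradiction refl (All.lookup x∉xs v∈xs)
  ... | inj₂ (there v∈vs) = ∈-++⁺ʳ us v∈vs

module _ {A : Set} (_≟_ : DecidableEquality A) where

  jump : A → A → ℕ
  jump x y = if does (x ≟ y) then 0 else 1

  changes : List A → ℕ
  changes []           = 0
  changes (x ∷ [])     = 0
  changes (x ∷ y ∷ ys) = jump x y ℕ.+ changes (y ∷ ys)

  length-derun≤1+changes : ∀ xs → length (derun _≟_ xs) ℕ.≤ suc (changes xs)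
  length-derun≤1+changes []           = z≤n
  length-derun≤1+changes (x ∷ [])     = ℕ.≤-refl
  length-derun≤1+changes (x ∷ y ∷ ys) with ih ← length-derun≤1+changes (y ∷ ys) | does (x ≟ y)
  ... | true  = ih
  ... | false = s≤s ih

  ≡⇒jump≡0 : ∀ {x y} → x ≡ y → jump x y ≡ 0
  ≡⇒jump≡0 {x} {y} x≡y with x ≟ y
  ... | yes _  = refl
  ... | no x≢y = contradiction x≡y x≢y

  changes-constant : ∀ {c xs} → All (_≡ c) xs → changes xs ≡ 0
  changes-constant []                   = refl
  changes-constant (_ ∷ [])             = refl
  changes-constant (x≡c ∷ y≡c ∷ ys≡c) =
    cong₂ ℕ._+_ (≡⇒jump≡0 (trans x≡c (sym y≡c))) (changes-constant (y≡c ∷ ys≡c))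

module _ {A B C D : Set}
         (_≟ᴮ_ : DecidableEquality B) (_≟ᶜ_ : DecidableEquality C) (_≟ᴰ_ : DecidableEquality D)
         (f : A → B) (g : A → C) (h : A → D)
         (determined : ∀ {x y} → f x ≡ f y → g x ≡ g y → h x ≡ h y) where

  jump-determined : ∀ x y → jump _≟ᴰ_ (h x) (h y) ℕ.≤ jump _≟ᴮ_ (f x) (f y) ℕ.+ jump _≟ᶜ_ (g x) (g y)
  jump-determined x y with h x ≟ᴰ h y | f x ≟ᴮ f y | g x ≟ᶜ g y
  ... | yes _  | _     | _     = z≤n
  ... | no _   | no _  | _     = s≤s z≤n
  ... | no _   | yes _ | no _  = s≤s z≤n
  ... | no h≢  | yes f≡ | yes g≡ = contradiction (determined f≡ g≡) h≢

  changes-map-determined : ∀ xs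
    → changes _≟ᴰ_ (map h xs) ℕ.≤ changes _≟ᴮ_ (map f xs) ℕ.+ changes _≟ᶜ_ (map g xs)
  changes-map-determined []           = z≤n
  changes-map-determined (x ∷ [])     = z≤n
  changes-map-determined (x ∷ y ∷ xs) = ℕ.≤-trans
    (ℕ.+-mono-≤ (jump-determined x y) (changes-map-determined (y ∷ xs)))
    (ℕ.≤-reflexive (interchange (jump _≟ᴮ_ (f x) (f y)) (jump _≟ᶜ_ (g x) (g y)) _ _))

residueClass : (q : ℕ) .{{_ : ℕ.NonZero q}} → ℕ → List ℕ → List ℕ
residueClass q r = filter (λ n → n % q ℕ.≟ r)

distinct≤residueRuns : ∀ {A : Set} (_≟_ : DecidableEquality A) (F : ℕ → A)
                       (q : ℕ) .{{_ : ℕ.NonZero q}} xs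
                     → length (deduplicate _≟_ (map F xs))
                       ℕ.≤ length (concatMap (λ r → derun _≟_ (map F (residueClass q r xs))) (upTo q))
distinct≤residueRuns _≟_ F q xs = Unique∧⊆⇒length-≤ (deduplicate-! _≟_ (map F xs)) covered
  where
  covered : deduplicate _≟_ (map F xs)
            ⊆ concatMap (λ r → derun _≟_ (map F (residueClass q r xs))) (upTo q)
  covered v∈ with ∈-map⁻ F (∈-deduplicate⁻ _≟_ (map F xs) v∈)
  ... | n , n∈xs , refl = ∈-concat⁺′
    (∈-derun⁺ _≟_ (∈-map⁺ F (∈-filter⁺ (λ m → m % q ℕ.≟ n % q) n∈xs refl)))
    (∈-map⁺ _ (∈-upTo⁺ (m%n<n n q)))

length-concatMap≤ : ∀ {A B : Set} (G : A → List B) {K} → (∀ a → ℕ→ℚ (length (G a)) ≤ K)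
                  → ∀ as → ℕ→ℚ (length (concatMap G as)) ≤ ℕ→ℚ (length as) * K
length-concatMap≤ G {K} G≤K [] = ≤-reflexive (sym (*-zeroˡ K))
length-concatMap≤ G {K} G≤K (a ∷ as) = begin
  ℕ→ℚ (length (G a ++ concatMap G as))                  ≡⟨ cong ℕ→ℚ (List.length-++ (G a)) ⟩
  ℕ→ℚ (length (G a) ℕ.+ length (concatMap G as))        ≡⟨ ℕ→ℚ-+ (length (G a)) _ ⟩
  ℕ→ℚ (length (G a)) + ℕ→ℚ (length (concatMap G as))
    ≤⟨ +-mono-≤ (G≤K a) (length-concatMap≤ G G≤K as) ⟩
  K + ℕ→ℚ (length as) * K                               ≡⟨ ℕ→ℚ-suc-* (length as) K ⟨
  ℕ→ℚ (suc (length as)) * K                             ∎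
  where open ≤-Reasoning

∈I⇒lo≤ : ∀ {x J} → x ∈I J → lo J ≤ x
∈I⇒lo≤ {J = record { loClosed = true  }} (lo≤x , _) = lo≤x
∈I⇒lo≤ {J = record { loClosed = false }} (lo<x , _) = <⇒≤ lo<x

∈I⇒≤hi : ∀ {x J} → x ∈I J → x ≤ hi J
∈I⇒≤hi {J = record { hiClosed = true  }} (_ , x≤hi) = x≤hi
∈I⇒≤hi {J = record { hiClosed = false }} (_ , x<hi) = <⇒≤ x<hi

interior⇒∈I : ∀ {x J} → lo J < x → x < hi J → x ∈I J
interior⇒∈I {J = J} lo<x x<hi = weaken (loClosed J) lo<x , weaken (hiClosed J) x<hi
  where
  weaken : ∀ b {p q} → p < q → if b then p ≤ q else p < q
  weaken true  = <⇒≤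
  weaken false = id

module _ {L : ℚ} (P : LinePartition L) where

  cell : ℚ → ℤ
  cell x = proj₁ (cover P x)

  cellLo : ℚ → ℚ
  cellLo x = lo (I P (cell x))

  ∈-cell : ∀ x → x ∈I I P (cell x)
  ∈-cell x = proj₂ (cover P x)

  hi≡lo+len : ∀ k → hi (I P k) ≡ lo (I P k) + L
  hi≡lo+len k = begin
    hi (I P k)                         ≡⟨ solve 2 (λ h l → h := (h :- l) :+ l) refl (hi (I P k)) (lo (I P k)) ⟩
    (hi (I P k) - lo (I P k)) + lo (I P k) ≡⟨ cong (_+ lo (I P k)) (len P k) ⟩
    L + lo (I P k)                     ≡⟨ +-comm L (lo (I P k)) ⟩
    lo (I P k) + L                     ∎
    where
    open ≡-Reasoning
    open +-*-Solver

  overlapping⇒≡ : ∀ {a b} → lo (I P a) ≤ lo (I P b) → lo (I P b) < hi (I P a) → a ≡ b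
  overlapping⇒≡ {a} {b} loa≤lob lob<hia = disj P z a b z∈Ia z∈Ib
    where
    z = proj₁ (<-dense lob<hia)
    lob<z = proj₁ (proj₂ (<-dense lob<hia))
    z<hia = proj₂ (proj₂ (<-dense lob<hia))
    hia≤hib : hi (I P a) ≤ hi (I P b)
    hia≤hib = subst₂ _≤_ (sym (hi≡lo+len a)) (sym (hi≡lo+len b)) (+-monoˡ-≤ L loa≤lob)
    z∈Ia = interior⇒∈I (≤-<-trans loa≤lob lob<z) z<hia
    z∈Ib = interior⇒∈I lob<z (<-≤-trans z<hia hia≤hib)

  cellLo-mono : ∀ {x y} → x < y → cell x ≢ cell y → cellLo x ≤ cellLo y
  cellLo-mono {x} {y} x<y x≁y with cellLo x ≤? cellLo y
  ... | yes lox≤loy = lox≤loy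
  ... | no  lox≰loy = contradiction (sym (overlapping⇒≡ (<⇒≤ (≰⇒> lox≰loy)) lox<hiy)) x≁y
    where
    lox<hiy = ≤-<-trans (∈I⇒lo≤ (∈-cell x)) (<-≤-trans x<y (∈I⇒≤hi (∈-cell y)))

  cell-spacing : ∀ {x y} → x < y → cell x ≢ cell y → cellLo x + L ≤ cellLo y
  cell-spacing {x} {y} x<y x≁y with cellLo y <? hi (I P (cell x))
  ... | yes loy<hix = contradiction (overlapping⇒≡ (cellLo-mono x<y x≁y) loy<hix) x≁y
  ... | no  loy≮hix = subst (_≤ cellLo y) (hi≡lo+len (cell x)) (≮⇒≥ loy≮hix)

  cell-changes : ∀ {b} x xs → Linked _<_ (x ∷ xs) → All (_≤ b) (x ∷ xs)
               → ℕ→ℚ (changes ℤ._≟_ (map cell (x ∷ xs))) * L + cellLo x ≤ b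
  cell-changes {b} x [] _ (x≤b ∷ []) = begin
    ℕ→ℚ 0 * L + cellLo x  ≡⟨ cong (_+ cellLo x) (*-zeroˡ L) ⟩
    0ℚ + cellLo x         ≡⟨ +-identityˡ (cellLo x) ⟩
    cellLo x              ≤⟨ ∈I⇒lo≤ (∈-cell x) ⟩
    x                     ≤⟨ x≤b ⟩
    b                     ∎
    where open ≤-Reasoning
  cell-changes {b} x (y ∷ ys) (x<y ∷ sorted) (_ ∷ bounded) with cell x ℤ.≟ cell y
  ... | yes x∼y = subst (λ k → ℕ→ℚ c * L + lo (I P k) ≤ b) (sym x∼y) (cell-changes y ys sorted bounded)
    where c = changes ℤ._≟_ (map cell (y ∷ ys))
  ... | no x≁y = begin
    ℕ→ℚ (suc c) * L + cellLo x
      ≡⟨ ℕ→ℚ-suc-*-+ c L (cellLo x) ⟩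
    ℕ→ℚ c * L + (cellLo x + L)
      ≤⟨ +-monoʳ-≤ (ℕ→ℚ c * L) (cell-spacing x<y x≁y) ⟩
    ℕ→ℚ c * L + cellLo y
      ≤⟨ cell-changes y ys sorted bounded ⟩
    b ∎
    where
    open ≤-Reasoning
    c = changes ℤ._≟_ (map cell (y ∷ ys))

  cell-changes-bound : ∀ {M a b} → 0ℚ ≤ M → M ≤ L
                     → ∀ x xs → Linked _<_ (x ∷ xs) → a ≤ x → All (_≤ b) (x ∷ xs)
                     → ℕ→ℚ (changes ℤ._≟_ (map cell (x ∷ xs))) * M + a ≤ b + M
  cell-changes-bound {M} {a} {b} 0≤M M≤L x xs sorted a≤x bounded
    with changes ℤ._≟_ (map cell (x ∷ xs)) | cell-changes x xs sorted bounded
  ... | zero  | _ = begin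
    ℕ→ℚ 0 * M + a  ≡⟨ cong (_+ a) (*-zeroˡ M) ⟩
    0ℚ + a         ≡⟨ +-identityˡ a ⟩
    a              ≤⟨ a≤x ⟩
    x              ≤⟨ All.head bounded ⟩
    b              ≤⟨ p≤p+q 0≤M ⟩
    b + M          ∎
    where open ≤-Reasoning
  ... | suc c | changes-bound = begin
    ℕ→ℚ (suc c) * M + a             ≡⟨ ℕ→ℚ-suc-*-+ c M a ⟩
    ℕ→ℚ c * M + (a + M)             ≡⟨ +-assoc (ℕ→ℚ c * M) a M ⟨
    ℕ→ℚ c * M + a + M               ≤⟨ +-monoˡ-≤ M (+-mono-≤ cM≤cL a≤lo+L) ⟩
    ℕ→ℚ c * L + (cellLo x + L) + M  ≡⟨ cong (_+ M) (ℕ→ℚ-suc-*-+ c L (cellLo x)) ⟨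
    ℕ→ℚ (suc c) * L + cellLo x + M  ≤⟨ +-monoˡ-≤ M changes-bound ⟩
    b + M                           ∎
    where
    open ≤-Reasoning
    cM≤cL = *-monoˡ-≤-nonNeg (ℕ→ℚ c) {{nonNegative (ℕ→ℚ-nonNeg c)}} M≤L
    a≤lo+L = ≤-trans a≤x (subst (x ≤_) (hi≡lo+len (cell x)) (∈I⇒≤hi (∈-cell x)))

%≡⇒%-divisor≡ : ∀ {m Q n r} .{{_ : ℕ.NonZero m}} .{{_ : ℕ.NonZero Q}}
              → m ∣ Q → n % Q ≡ r → n % m ≡ r % m
%≡⇒%-divisor≡ {m} {Q} {n} m∣Q n%Q≡r = trans (sym (m∣n⇒o%n%m≡o%m m Q n m∣Q)) (cong (_% m) n%Q≡r)

lcm-nonZero : ∀ m n .{{_ : ℕ.NonZero m}} .{{_ : ℕ.NonZero n}} → ℕ.NonZero (lcm m n)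
lcm-nonZero m n = ℕ.≢-nonZero λ lcm≡0 → ℕ.≢-nonZero⁻¹ (m ℕ.* n) {{ℕ.m*n≢0 m n}} (begin
  m ℕ.* n                ≡⟨ gcd*lcm m n ⟨
  gcd m n ℕ.* lcm m n    ≡⟨ cong (gcd m n ℕ.*_) lcm≡0 ⟩
  gcd m n ℕ.* 0          ≡⟨ ℕ.*-zeroʳ (gcd m n) ⟩
  0                      ∎)
  where open ≡-Reasoning

joinModulus-nonZero : ∀ {d} (Bs : Vec SimpleLocalFactor d) → ℕ.NonZero (joinModulus Bs)
joinModulus-nonZero []       = _
joinModulus-nonZero (B ∷ Bs) =
  lcm-nonZero (modulus B) (joinModulus Bs) {{modulus-nonZero B}} {{joinModulus-nonZero Bs}}

changes-joinLabel-∷ : ∀ {d Q r} .{{_ : ℕ.NonZero Q}} (B : SimpleLocalFactor) (Bs : Vec SimpleLocalFactor d)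
                    → modulus B ∣ Q → ∀ {ns} → All (λ n → n % Q ≡ r) ns
                    → changes joinLabel-≟ (map (joinLabel (B ∷ Bs)) ns)
                      ℕ.≤ changes ℤ._≟_ (map (realLabel (realPart B)) ns)
                          ℕ.+ changes joinLabel-≟ (map (joinLabel Bs) ns)
changes-joinLabel-∷ B Bs qB∣Q {ns} congruent = begin
  changes joinLabel-≟ (map (joinLabel (B ∷ Bs)) ns)
    ≤⟨ changes-map-determined localLabel-≟ joinLabel-≟ joinLabel-≟
         (localLabel B) (joinLabel Bs) (joinLabel (B ∷ Bs)) (cong₂ _∷_) ns ⟩
  changes localLabel-≟ (map (localLabel B) ns) ℕ.+ cJ
    ≤⟨ ℕ.+-monoˡ-≤ cJ (changes-map-determined ℤ._≟_ ℕ._≟_ localLabel-≟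
         realLabelB (congLabel (modulus B)) (localLabel B) (cong₂ _,_) ns) ⟩
  cR ℕ.+ changes ℕ._≟_ (map (congLabel (modulus B)) ns) ℕ.+ cJ
    ≡⟨ cong (λ c → cR ℕ.+ c ℕ.+ cJ)
         (changes-constant ℕ._≟_ (All.map⁺ (All.map (%≡⇒%-divisor≡ qB∣Q) congruent))) ⟩
  cR ℕ.+ 0 ℕ.+ cJ
    ≡⟨ cong (ℕ._+ cJ) (ℕ.+-identityʳ cR) ⟩
  cR ℕ.+ cJ ∎
  where
  open ℕ.≤-Reasoning
  localLabel-≟ = Product.≡-dec ℤ._≟_ ℕ._≟_
  realLabelB = realLabel (realPart B)
  cR = changes ℤ._≟_ (map realLabelB ns)
  cJ = changes joinLabel-≟ (map (joinLabel Bs) ns)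

module _ {M : ℚ} .{{_ : Positive M}} where

  private instance
    M-nonZero : NonZero M
    M-nonZero = pos⇒nonZero M

  realChanges≤ : ∀ {N} (B : SimpleLocalFactor) → M ≤ res B
               → ∀ {ns} → Linked ℕ._<_ ns → All (ℕ._≤ N) ns
               → ℕ→ℚ (changes ℤ._≟_ (map (realLabel (realPart B)) ns)) ≤ ℕ→ℚ N ÷ M + 1ℚ
  realChanges≤ {N} B M≤L {ns} sorted bounded = *≤+⇒≤÷+1 {q = ℕ→ℚ N} M (scaled ns sorted bounded)
    where
    open ≤-Reasoning
    0≤M = <⇒≤ (positive⁻¹ M)
    scaled : ∀ ns → Linked ℕ._<_ ns → All (ℕ._≤ N) ns
           → ℕ→ℚ (changes ℤ._≟_ (map (realLabel (realPart B)) ns)) * M ≤ ℕ→ℚ N + M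
    scaled [] _ _ = begin
      ℕ→ℚ 0 * M     ≡⟨ *-zeroˡ M ⟩
      0ℚ            ≤⟨ ℕ→ℚ-nonNeg N ⟩
      ℕ→ℚ N         ≤⟨ p≤p+q 0≤M ⟩
      ℕ→ℚ N + M     ∎
    scaled (n ∷ ns) sorted bounded = begin
      ℕ→ℚ (changes ℤ._≟_ (map (realLabel (realPart B)) (n ∷ ns))) * M
        ≡⟨ cong (λ ks → ℕ→ℚ (changes ℤ._≟_ ks) * M) (List.map-∘ (n ∷ ns)) ⟩
      ℕ→ℚ (changes ℤ._≟_ (map (cell (realPart B)) (map ℕ→ℚ (n ∷ ns)))) * M
        ≡⟨ +-identityʳ _ ⟨
      ℕ→ℚ (changes ℤ._≟_ (map (cell (realPart B)) (map ℕ→ℚ (n ∷ ns)))) * M + 0ℚ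
        ≤⟨ cell-changes-bound (realPart B) 0≤M M≤L (ℕ→ℚ n) (map ℕ→ℚ ns)
             (Linked.map⁺ (Linked.map ℕ→ℚ-mono-< sorted)) (ℕ→ℚ-nonNeg n)
             (All.map⁺ (All.map ℕ→ℚ-mono-≤ bounded)) ⟩
      ℕ→ℚ N + M ∎

  joinChanges≤ : ∀ {N Q r d} .{{_ : ℕ.NonZero Q}} (Bs : Vec SimpleLocalFactor d)
               → joinModulus Bs ∣ Q → AllResAtLeast M Bs
               → ∀ {ns} → Linked ℕ._<_ ns → All (ℕ._≤ N) ns → All (λ n → n % Q ≡ r) ns
               → ℕ→ℚ (changes joinLabel-≟ (map (joinLabel Bs) ns)) ≤ ℕ→ℚ d * (ℕ→ℚ N ÷ M + 1ℚ)
  joinChanges≤ {N} [] _ _ {ns} _ _ _ = begin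
    ℕ→ℚ (changes joinLabel-≟ (map (joinLabel []) ns))
      ≡⟨ cong ℕ→ℚ (changes-constant joinLabel-≟ (All.map⁺ (All.universal (λ _ → refl) ns))) ⟩
    0ℚ                                 ≡⟨ *-zeroˡ (ℕ→ℚ N ÷ M + 1ℚ) ⟨
    ℕ→ℚ 0 * (ℕ→ℚ N ÷ M + 1ℚ)           ∎
    where open ≤-Reasoning
  joinChanges≤ {N} {d = suc d} (B ∷ Bs) q∣Q res≥M {ns} sorted bounded congruent = begin
    ℕ→ℚ (changes joinLabel-≟ (map (joinLabel (B ∷ Bs)) ns))
      ≤⟨ ℕ→ℚ-mono-≤ (changes-joinLabel-∷ B Bs (∣-trans (m∣lcm[m,n] _ _) q∣Q) congruent) ⟩
    ℕ→ℚ (cR ℕ.+ cJ)           ≡⟨ ℕ→ℚ-+ cR cJ ⟩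
    ℕ→ℚ cR + ℕ→ℚ cJ
      ≤⟨ +-mono-≤ (realChanges≤ B (res≥M Fin.zero) sorted bounded)
                  (joinChanges≤ Bs (∣-trans (n∣lcm[m,n] (modulus B) _) q∣Q) (res≥M ∘ Fin.suc)
                     sorted bounded congruent) ⟩
    X + ℕ→ℚ d * X             ≡⟨ ℕ→ℚ-suc-* d X ⟨
    ℕ→ℚ (suc d) * X           ∎
    where
    open ≤-Reasoning
    X = ℕ→ℚ N ÷ M + 1ℚ
    cR = changes ℤ._≟_ (map (realLabel (realPart B)) ns)
    cJ = changes joinLabel-≟ (map (joinLabel Bs) ns)

  joinRuns≤ : ∀ {N Q r d} .{{_ : ℕ.NonZero Q}} .{{_ : ℕ.NonZero d}} (Bs : Vec SimpleLocalFactor d)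
            → joinModulus Bs ∣ Q → AllResAtLeast M Bs
            → ∀ {ns} → Linked ℕ._<_ ns → All (ℕ._≤ N) ns → All (λ n → n % Q ≡ r) ns
            → ℕ→ℚ (length (derun joinLabel-≟ (map (joinLabel Bs) ns)))
              ≤ ℕ→ℚ d * (ℕ→ℚ N ÷ M + ℕ→ℚ 2)
  joinRuns≤ {N} {d = d} Bs q∣Q res≥M {ns} sorted bounded congruent = begin
    ℕ→ℚ (length (derun joinLabel-≟ (map (joinLabel Bs) ns)))
      ≤⟨ ℕ→ℚ-mono-≤ (length-derun≤1+changes joinLabel-≟ (map (joinLabel Bs) ns)) ⟩
    ℕ→ℚ (1 ℕ.+ c)             ≡⟨ ℕ→ℚ-+ 1 c ⟩
    1ℚ + ℕ→ℚ c
      ≤⟨ +-mono-≤ (ℕ→ℚ-mono-≤ (ℕ.>-nonZero⁻¹ d))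
                  (joinChanges≤ Bs q∣Q res≥M sorted bounded congruent) ⟩
    ℕ→ℚ d + ℕ→ℚ d * (X + 1ℚ)
      ≡⟨ solve 2 (λ d X → d :+ d :* (X :+ con 1ℚ) := d :* (X :+ con (ℕ→ℚ 2))) refl (ℕ→ℚ d) X ⟩
    ℕ→ℚ d * (X + ℕ→ℚ 2)       ∎
    where
    open ≤-Reasoning
    open +-*-Solver
    X = ℕ→ℚ N ÷ M
    c = changes joinLabel-≟ (map (joinLabel Bs) ns)

[N]-increasing : ∀ N → Linked ℕ._<_ [ N ]
[N]-increasing N = Linked.map⁺ (Linked.applyUpTo⁺₂ id N (λ i → ℕ.n<1+n (suc i)))

[N]-bounded : ∀ N → All (ℕ._≤ N) [ N ]
[N]-bounded N = All.map⁺ (All.all-upTo N)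

lemma4p5 : (N : ℕ) → .{{ℕ.NonZero N}} → (d : ℕ) → .{{ℕ.NonZero d}}
         → (M : ℚ) → (Mpos : Positive M)
         → (Bs : Vec SimpleLocalFactor d) → AllResAtLeast M Bs
         → ℕ→ℚ (joinSize N Bs)
           ≤ ℕ→ℚ (joinModulus Bs) * ℕ→ℚ d
             * ((_÷_ (ℕ→ℚ N) M {{pos⇒nonZero M {{Mpos}}}}) + ℕ→ℚ 2)
lemma4p5 N d M Mpos Bs res≥M = begin
  ℕ→ℚ (joinSize N Bs)
    ≤⟨ ℕ→ℚ-mono-≤ (distinct≤residueRuns joinLabel-≟ (joinLabel Bs) q [ N ]) ⟩
  ℕ→ℚ (length (concatMap runs (upTo q)))
    ≤⟨ length-concatMap≤ runs runs≤ (upTo q) ⟩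
  ℕ→ℚ (length (upTo q)) * (ℕ→ℚ d * X)
    ≡⟨ cong (λ n → ℕ→ℚ n * (ℕ→ℚ d * X)) (List.length-upTo q) ⟩
  ℕ→ℚ q * (ℕ→ℚ d * X)
    ≡⟨ *-assoc (ℕ→ℚ q) (ℕ→ℚ d) X ⟨
  ℕ→ℚ q * ℕ→ℚ d * X ∎
  where
  open ≤-Reasoning
  instance
    _ = Mpos
    _ = pos⇒nonZero M
    _ = joinModulus-nonZero Bs
  q = joinModulus Bs
  X = ℕ→ℚ N ÷ M + ℕ→ℚ 2
  runs = λ r → derun joinLabel-≟ (map (joinLabel Bs) (residueClass q r [ N ]))
  runs≤ : ∀ r → ℕ→ℚ (length (runs r)) ≤ ℕ→ℚ d * X
  runs≤ r = joinRuns≤ Bs ∣-refl res≥M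
    (Linked.filter⁺ (λ n → n % q ℕ.≟ r) ℕ.<-trans ([N]-increasing N))
    (All.filter⁺ (λ n → n % q ℕ.≟ r) ([N]-bounded N))
    (All.all-filter (λ n → n % q ℕ.≟ r) [ N ])
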